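{- Let $G$ be an event graph. Then its decorated graph $\mathrm{dec}(G)$ has exactly one sink component, namely the sink component $\mathcal C$ that is reachable from every node of the form $(v,\emptyset)$, $v\in V$.
   Context: An event graph is a finite, connected, undirected graph $G=(V,E)$ in which every node $v$ carries a label of the form $\texttt{i}x_v$ (insert) or $\texttt{d}x_v$ (delete), where $x_v$ is an element of a finite universe $\mathcal U$. Let $\mathcal U_{|V}=\{x_v : v\in V\}$. It is assumed that for every $x\in\mathcal U_{|V}$ there is at least one node labeled $\texttt{i}x$ and at least one node labeled $\texttt{d}x$. The decorated graph $\mathrm{dec}(G)$ is the directed graph with vertex set $V\times 2^{\mathcal U_{|V}}$, in which $((u,X),(v,Y))$ is an edge iff $\{u,v\}\in E$ and $Y=X\cup\{x_v\}$ if $v$ is labeled $\texttt{i}x_v$, resp. $Y=X\setminus\{x_v\}$ if $v$ is labeled $\texttt{d}x_v$. A sink component is a strongly connected component of $\mathrm{dec}(G)$ with no edges leaving it. -}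

module Defs where

open import Level using (0ℓ)
open import Data.Nat using (ℕ)
open import Data.Fin using (Fin)
open import Data.Fin.Subset using (Subset; Side; inside; outside; _∈_; _⊆_) renaming (⊥ to ∅)
open import Data.Vec using (_[_]≔_)
open import Data.Product using (Σ; ∃; _×_; _,_)
open import Data.Empty using (⊥)
open import Relation.Nullary using (¬_)
open import Relation.Binary using (Rel)
open import Relation.Binary.PropositionalEquality using (_≡_)
open import Relation.Binary.Construct.Closure.ReflexiveTransitive using (Star)

data Op : Set where
  ins del : Op

record EventGraph : Set₁ where
  field
    n       : ℕ
    m       : ℕ
    E       : Rel (Fin n) 0ℓ
    E-sym   : ∀ {u v} → E u v → E v u
    E-irr   : ∀ {v} → ¬ E v v
    op      : Fin n → Op
    elt     : Fin n → Fin m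
    -- connected (and hence non-empty)
    nonempty  : Fin n
    connected : ∀ u v → Star E u v
  Used : Fin m → Set
  Used x = ∃ λ v → elt v ≡ x
  field
    has-ins : ∀ x → Used x → ∃ λ v → op v ≡ ins × elt v ≡ x
    has-del : ∀ x → Used x → ∃ λ v → op v ≡ del × elt v ≡ x

module Dec (G : EventGraph) where
  open EventGraph G

  -- candidate nodes (v , X); the vertex set of dec(G) is those with X ⊆ 𝒰_{|V}
  Node : Set
  Node = Fin n × Subset m

  Valid : Node → Set
  Valid (v , X) = ∀ {x} → x ∈ X → Used x

  apply : Op → Fin m → Subset m → Subset m
  apply ins x X = X [ x ]≔ inside
  apply del x X = X [ x ]≔ outside

  DEdge : Node → Node → Set
  DEdge (u , X) (v , Y) = Valid (u , X) × Valid (v , Y) × E u v × Y ≡ apply (op v) (elt v) X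

  Reach : Node → Node → Set
  Reach = Star DEdge

  IsSCC : (Node → Set) → Set
  IsSCC C =
    (∃ λ a → C a) ×
    (∀ a → C a → Valid a) ×
    (∀ a b → C a → C b → Reach a b) ×
    (∀ a b → C a → Valid b → Reach a b → Reach b a → C b)

  IsSinkComponent : (Node → Set) → Set
  IsSinkComponent C = IsSCC C × (∀ a b → C a → DEdge a b → C b)

  emptyNode : Fin n → Node
  emptyNode v = (v , ∅)

-- Run any closed walk from a fixed root v₀ through the decoration: each node it
-- visits overwrites the membership bit of its label, so after a walk that goes
-- out to w and back, the bit of x_w no longer depends on the starting set.
-- A tour visiting every node passes through both the insert and the delete node
-- of every x ∈ 𝒰_{|V}; these are distinct, so one of them differs from v₀ and the
-- tour fixes the bit of x. Bits outside 𝒰_{|V} are always 0. Hence the tour sends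
-- every vertex (v₀ , X) to one and the same vertex t, which is therefore reachable
-- from every vertex of dec(G), and the vertices reachable from t form the unique
-- sink component.
module Submission where

open import Level using (0ℓ)
open import Data.Nat using (ℕ)
open import Data.Bool using (false; true)
open import Data.Fin using (Fin; _≟_)
open import Data.Fin.Subset using (Side; inside; outside) renaming (⊥ to ∅)
open import Data.Vec using (Vec; lookup; tabulate; _[_]≔_)
open import Data.Vec.Properties
  using (lookup∘update; lookup∘update′; []=⇒lookup; lookup⇒[]=; lookup-replicate; tabulate∘lookup; tabulate-cong)
open import Data.List using (List; []; _∷_; allFin)
open import Data.List.Membership.Propositional using (_∈_)
open import Data.List.Membership.Propositional.Properties using (∈-allFin)
open import Data.List.Relation.Unary.Any using (here; there)
open import Data.Product using (Σ; ∃; _×_; _,_; proj₁; proj₂)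
open import Function using (id)
open import Function.Bundles using (_⇔_; mk⇔)
open import Relation.Nullary using (¬_; yes; no)
open import Relation.Binary using (Rel)
open import Relation.Binary.PropositionalEquality
open import Relation.Binary.Construct.Closure.ReflexiveTransitive using (Star; ε; _◅_; _◅◅_; fold)

open import Defs

lookup-ext : ∀ {A : Set} {k} (xs ys : Vec A k) → (∀ i → lookup xs i ≡ lookup ys i) → xs ≡ ys
lookup-ext xs ys eq = begin
  xs                   ≡⟨ sym (tabulate∘lookup xs) ⟩
  tabulate (lookup xs) ≡⟨ tabulate-cong eq ⟩
  tabulate (lookup ys) ≡⟨ tabulate∘lookup ys ⟩
  ys                   ∎
  where open ≡-Reasoning

update-preserves-agreement : ∀ {A : Set} {k} (X Y : Vec A k) j a i →
  lookup X i ≡ lookup Y i → lookup (X [ j ]≔ a) i ≡ lookup (Y [ j ]≔ a) i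
update-preserves-agreement X Y j a i agree with i ≟ j
... | yes refl = trans (lookup∘update i X a) (sym (lookup∘update i Y a))
... | no i≢j   = trans (lookup∘update′ i≢j X a) (trans agree (sym (lookup∘update′ i≢j Y a)))

module Writes {V : Set} (E : Rel V 0ℓ) {A : Set} {k : ℕ} (key : V → Fin k) (val : V → A) where

  write : V → Vec A k → Vec A k
  write v X = X [ key v ]≔ val v

  -- The starting node of a walk does not act.
  run : ∀ {a b} → Star E a b → Vec A k → Vec A k
  run ε X = X
  run (_◅_ {j = c} _ p) X = run p (write c X)

  run-◅◅ : ∀ {a b c} (p : Star E a b) (q : Star E b c) X → run (p ◅◅ q) X ≡ run q (run p X)
  run-◅◅ ε q X = refl
  run-◅◅ (_ ◅ p) q X = run-◅◅ p q _

  run-preserves-agreement : ∀ {a b} (p : Star E a b) X Y i →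
    lookup X i ≡ lookup Y i → lookup (run p X) i ≡ lookup (run p Y) i
  run-preserves-agreement ε X Y i agree = agree
  run-preserves-agreement (_◅_ {j = c} _ p) X Y i agree =
    run-preserves-agreement p _ _ i (update-preserves-agreement X Y (key c) (val c) i agree)

  run-◅-endpoint : ∀ {a c b} (e : E a c) (p : Star E c b) X → lookup (run (e ◅ p) X) (key b) ≡ val b
  run-◅-endpoint {c = c} _ ε X = lookup∘update (key c) X (val c)
  run-◅-endpoint _ (f ◅ p) X = run-◅-endpoint f p _

  run-endpoint : ∀ {a b} (p : Star E a b) → ¬ a ≡ b → ∀ X → lookup (run p X) (key b) ≡ val b
  run-endpoint ε a≢b X with () ← a≢b refl
  run-endpoint (e ◅ p) _ X = run-◅-endpoint e p X

  module Tour (r : V) (connected : ∀ u v → Star E u v) where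

    tour : List V → Star E r r
    tour [] = ε
    tour (w ∷ ws) = (connected r w ◅◅ connected w r) ◅◅ tour ws

    tour-fixes-visited : ∀ {w ws} → w ∈ ws → ¬ r ≡ w → ∀ X Y →
      lookup (run (tour ws) X) (key w) ≡ lookup (run (tour ws) Y) (key w)
    tour-fixes-visited {w} {_ ∷ ws} (here refl) r≢w X Y
      rewrite run-◅◅ (connected r w ◅◅ connected w r) (tour ws) X
            | run-◅◅ (connected r w ◅◅ connected w r) (tour ws) Y
            | run-◅◅ (connected r w) (connected w r) X
            | run-◅◅ (connected r w) (connected w r) Y
      = run-preserves-agreement (tour ws) _ _ (key w)
          (run-preserves-agreement (connected w r) _ _ (key w)
            (trans (run-endpoint (connected r w) r≢w X) (sym (run-endpoint (connected r w) r≢w Y))))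
    tour-fixes-visited {w} {u ∷ ws} (there w∈ws) r≢w X Y
      rewrite run-◅◅ (connected r u ◅◅ connected u r) (tour ws) X
            | run-◅◅ (connected r u ◅◅ connected u r) (tour ws) Y
      = tour-fixes-visited w∈ws r≢w _ _

module _ (G : EventGraph) where
  open EventGraph G
  open Dec G

  side : Op → Side
  side ins = inside
  side del = outside

  apply-as-update : ∀ o x X → apply o x X ≡ X [ x ]≔ side o
  apply-as-update ins x X = refl
  apply-as-update del x X = refl

  open Writes E elt (λ v → side (op v))

  reach-closed : (D : Node → Set) → (∀ a b → D a → DEdge a b → D b) → ∀ {a b} → Reach a b → D a → D b
  reach-closed D closed = fold (λ a b → D a → D b) (λ {a} {b} e k d → k (closed a b d e)) id

  reach-valid : ∀ {a b} → Reach a b → Valid a → Valid b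
  reach-valid = reach-closed Valid (λ _ _ _ e → proj₁ (proj₂ e))

  ∅-valid : ∀ v → Valid (v , ∅)
  ∅-valid v {x} x∈∅ with () ← trans (sym ([]=⇒lookup x∈∅)) (lookup-replicate x outside)

  write-valid : ∀ u v w X → Valid (u , X) → Valid (v , write w X)
  write-valid u v w X X-valid {x} x∈ with x ≟ elt w
  ... | yes refl = w , refl
  ... | no x≢w = X-valid (lookup⇒[]= x X (trans (sym (lookup∘update′ x≢w X (side (op w)))) ([]=⇒lookup x∈)))

  lift-walk : ∀ {a b} (p : Star E a b) X → Valid (a , X) → Reach (a , X) (b , run p X)
  lift-walk ε X _ = ε
  lift-walk {a} (_◅_ {j = c} e p) X X-valid =
    (X-valid , Y-valid , e , sym (apply-as-update (op c) (elt c) X))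
    ◅ lift-walk p (write c X) Y-valid
    where
    Y-valid : Valid (c , write c X)
    Y-valid = write-valid a c c X X-valid

  valid-agree-on-unused : ∀ u v X Y x → Valid (u , X) → Valid (v , Y) →
    (Used x → lookup X x ≡ lookup Y x) → lookup X x ≡ lookup Y x
  valid-agree-on-unused u v X Y x X-valid Y-valid agree with lookup X x in X[x] | lookup Y x in Y[x]
  ... | false | false = refl
  ... | true  | true  = refl
  ... | true  | false = agree (X-valid (lookup⇒[]= x X X[x]))
  ... | false | true  = agree (Y-valid (lookup⇒[]= x Y Y[x]))

  v₀ : Fin n
  v₀ = nonempty

  open Tour v₀ connected

  grand-tour : Star E v₀ v₀
  grand-tour = tour (allFin n)

  grand-tour-fixes-labels : ∀ x → Used x → ∀ X Y → lookup (run grand-tour X) x ≡ lookup (run grand-tour Y) x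
  grand-tour-fixes-labels x used X Y with has-ins x used | has-del x used
  ... | vᵢ , opᵢ , refl | v_d , op_d , elt_d with v₀ ≟ vᵢ
  ... | no v₀≢vᵢ = tour-fixes-visited (∈-allFin vᵢ) v₀≢vᵢ X Y
  ... | yes refl rewrite sym elt_d = tour-fixes-visited (∈-allFin v_d) v₀≢v_d X Y
    where
    v₀≢v_d : ¬ v₀ ≡ v_d
    v₀≢v_d refl with () ← trans (sym opᵢ) op_d

  attractor : Node
  attractor = v₀ , run grand-tour ∅

  attractor-valid : Valid attractor
  attractor-valid = reach-valid (lift-walk grand-tour ∅ (∅-valid v₀)) (∅-valid v₀)

  grand-tour-constant : ∀ X → Valid (v₀ , X) → run grand-tour X ≡ run grand-tour ∅
  grand-tour-constant X X-valid = lookup-ext _ _ λ x →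
    valid-agree-on-unused v₀ v₀ _ _ x
      (reach-valid (lift-walk grand-tour X X-valid) X-valid) attractor-valid
      (λ used → grand-tour-fixes-labels x used X ∅)

  reach-attractor : ∀ a → Valid a → Reach a attractor
  reach-attractor (u , X) X-valid =
    lift-walk (connected u v₀) X X-valid ◅◅
    subst (λ Z → Reach (v₀ , Y) (v₀ , Z)) (grand-tour-constant Y Y-valid) (lift-walk grand-tour Y Y-valid)
    where
    Y = run (connected u v₀) X
    Y-valid : Valid (v₀ , Y)
    Y-valid = reach-valid (lift-walk (connected u v₀) X X-valid) X-valid

  module _ (t : Node) (t-valid : Valid t) (reach-t : ∀ a → Valid a → Reach a t) where

    ReachableFrom : Node → Set
    ReachableFrom b = Valid b × Reach t b

    reachableFrom-isSinkComponent : IsSinkComponent ReachableFrom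
    reachableFrom-isSinkComponent =
      ( (t , (λ {x} → t-valid {x}) , ε)
      , (λ _ → proj₁)
      , (λ a _ a∈C b∈C → reach-t a (proj₁ a∈C) ◅◅ proj₂ b∈C)
      , (λ _ _ a∈C b-valid a→b _ → b-valid , proj₂ a∈C ◅◅ a→b) )
      , λ _ _ a∈C e → proj₁ (proj₂ e) , proj₂ a∈C ◅◅ (e ◅ ε)

    sinkComponent-unique : ∀ D → IsSinkComponent D → ∀ a → D a ⇔ ReachableFrom a
    sinkComponent-unique D (((d , d∈D) , D-valid , D-strong , _) , D-closed) a =
      mk⇔ (λ a∈D → (λ {x} → D-valid a a∈D {x}) , D-strong t a t∈D a∈D)
          (λ a∈C → reach-closed D D-closed (proj₂ a∈C) t∈D)
      where
      t∈D : D t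
      t∈D = reach-closed D D-closed (reach-t d (D-valid d d∈D)) d∈D

corollary1 : (G : EventGraph) → let open Dec G in
    Σ (Node → Set) λ C →
    IsSinkComponent C ×
    (∀ v → ∃ λ c → C c × Reach (emptyNode v) c) ×
    (∀ D → IsSinkComponent D → ∀ a → D a ⇔ C a)
corollary1 G =
    ReachableFrom G t t-valid reach-t
  , reachableFrom-isSinkComponent G t t-valid reach-t
  , (λ v → t , ((λ {x} → t-valid {x}) , ε) , reach-t (v , ∅) (∅-valid G v))
  , sinkComponent-unique G t t-valid reach-t
  where
  t = attractor G
  t-valid = attractor-valid G
  reach-t = reach-attractor G
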